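{- Let $G$ and $H$ be connected graphs and let $R\subseteq V(G\,\square\,H)$ have the following two properties: (i) if $(g,h)\in R$, then $V({}^{g}H)\cap R=\{(g,h)\}$ or $V(G^{h})\cap R=\{(g,h)\}$; (ii) $\pi_G(R)$ and $\pi_H(R)$ are general position sets of $G$ and $H$, respectively. Then $R$ is a general position set of $G\,\square\,H$.
   Context: A general position set of a graph $G$ is a set $S\subseteq V(G)$ such that no three vertices of $S$ lie on a common shortest path of $G$. The Cartesian product $G\,\square\,H$ has vertex set $V(G)\times V(H)$, with $(g_1,h_1)$ adjacent to $(g_2,h_2)$ iff either $g_1g_2\in E(G)$ and $h_1=h_2$, or $g_1=g_2$ and $h_1h_2\in E(H)$. For $g\in V(G)$, the $H$-layer ${}^{g}H$ is the subgraph induced by $\{(g,h): h\in V(H)\}$; for $h\in V(H)$, the $G$-layer $G^{h}$ is the subgraph induced by $\{(g,h): g\in V(G)\}$. For $S\subseteq V(G\,\square\,H)$, $\pi_G(S)=\{g\in V(G): (g,h)\in S \text{ for some } h\}$ and $\pi_H(S)$ is defined analogously. -}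

module Defs where

open import Level using (0ℓ)
open import Data.Nat using (ℕ; zero; suc; _≤_)
open import Data.Fin using (Fin)
open import Data.Product using (Σ; ∃; _×_; _,_)
open import Data.Sum using (_⊎_)
open import Data.Empty using (⊥)
open import Relation.Nullary using (¬_)
open import Relation.Binary.PropositionalEquality using (_≡_)

record Graph : Set₁ where
  field
    n      : ℕ
    Adj    : Fin n → Fin n → Set
    sym    : ∀ {x y} → Adj x y → Adj y x
    irrefl : ∀ {x} → ¬ Adj x x

data Walk {V : Set} (E : V → V → Set) : V → V → Set where
  []  : ∀ {x} → Walk E x x
  _∷_ : ∀ {x y z} → E x y → Walk E y z → Walk E x z

length : ∀ {V : Set} {E : V → V → Set} {x y} → Walk E x y → ℕ
length []      = zero
length (_ ∷ w) = suc (length w)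

data _∈W_ {V : Set} {E : V → V → Set} (v : V) : ∀ {x y} → Walk E x y → Set where
  here  : ∀ {y} {w : Walk E v y} → v ∈W w
  there : ∀ {x y z} {e : E x y} {w : Walk E y z} → v ∈W w → v ∈W (e ∷ w)

IsShortest : ∀ {V : Set} {E : V → V → Set} {x y} → Walk E x y → Set
IsShortest {E = E} {x} {y} w = ∀ (w' : Walk E x y) → length w ≤ length w'

Connected : ∀ {V : Set} → (V → V → Set) → Set
Connected {V} E = ∀ (x y : V) → Walk E x y

GeneralPosition : ∀ {V : Set} → (V → V → Set) → (V → Set) → Set
GeneralPosition {V} E S =
  ∀ (a b c : V) → S a → S b → S c →
  ¬ a ≡ b → ¬ b ≡ c → ¬ a ≡ c →
  ∀ {x y} (w : Walk E x y) → IsShortest w →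
  ¬ (a ∈W w × b ∈W w × c ∈W w)

V : Graph → Set
V G = Fin (Graph.n G)

data □Adj (G H : Graph) : V G × V H → V G × V H → Set where
  stepG : ∀ {g₁ g₂ h} → Graph.Adj G g₁ g₂ → □Adj G H (g₁ , h) (g₂ , h)
  stepH : ∀ {g h₁ h₂} → Graph.Adj H h₁ h₂ → □Adj G H (g , h₁) (g , h₂)

πG : ∀ (G H : Graph) → (V G × V H → Set) → V G → Set
πG G H R g = ∃ λ h → R (g , h)

πH : ∀ (G H : Graph) → (V G × V H → Set) → V H → Set
πH G H R h = ∃ λ g → R (g , h)

{-# OPTIONS --safe #-}
-- A shortest path of G □ H projects onto shortest paths of G and H, since its
-- length is the sum of the lengths of its two projections and any pair of
-- walks in G and H can be run one after the other in G □ H. So if three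
-- vertices of R on a shortest path had pairwise distinct G-coordinates (or
-- H-coordinates), their projections would violate (ii). Otherwise two of them
-- share a G-coordinate and two share an H-coordinate; these pairs meet in a
-- vertex of R that has a second vertex of R both in its H-layer and in its
-- G-layer, contradicting (i).
module Submission where

open import Defs
open import Data.Nat using (suc; _+_)
open import Data.Nat.Properties using (+-suc; +-comm; +-cancelʳ-≤)
open Data.Nat.Properties.≤-Reasoning
open import Data.Fin using (_≟_)
open import Data.Product using (_×_; _,_; proj₁; proj₂)
open import Data.Product.Properties using (×-≡,≡→≡)
open import Data.Sum using (_⊎_; inj₁; inj₂)
open import Data.Empty using (⊥; ⊥-elim)
open import Function using (_∘_)
open import Relation.Nullary using (¬_; yes; no)
open import Relation.Binary.Definitions using (DecidableEquality)
open import Relation.Binary.PropositionalEquality using (_≡_; refl; sym; trans; cong; cong₂)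

module _ {A : Set} {E : A → A → Set} where

  _++ᵂ_ : ∀ {x y z} → Walk E x y → Walk E y z → Walk E x z
  []      ++ᵂ q = q
  (e ∷ p) ++ᵂ q = e ∷ (p ++ᵂ q)

  length-++ᵂ : ∀ {x y z} (p : Walk E x y) (q : Walk E y z) →
               length (p ++ᵂ q) ≡ length p + length q
  length-++ᵂ []      q = refl
  length-++ᵂ (e ∷ p) q = cong suc (length-++ᵂ p q)

module _ {A B : Set} {E : A → A → Set} {F : B → B → Set}
         (f : A → B) (f-step : ∀ {x y} → E x y → F (f x) (f y)) where

  mapᵂ : ∀ {x y} → Walk E x y → Walk F (f x) (f y)
  mapᵂ []      = []
  mapᵂ (e ∷ p) = f-step e ∷ mapᵂ p

  length-mapᵂ : ∀ {x y} (p : Walk E x y) → length (mapᵂ p) ≡ length p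
  length-mapᵂ []      = refl
  length-mapᵂ (e ∷ p) = cong suc (length-mapᵂ p)

module _ (G H : Graph) where

  private
    AdjG : V G → V G → Set
    AdjG = Graph.Adj G

    AdjH : V H → V H → Set
    AdjH = Graph.Adj H

    Adj□ : V G × V H → V G × V H → Set
    Adj□ = □Adj G H

  projG : ∀ {x y} → Walk Adj□ x y → Walk AdjG (proj₁ x) (proj₁ y)
  projG []            = []
  projG (stepG e ∷ w) = e ∷ projG w
  projG (stepH e ∷ w) = projG w

  projH : ∀ {x y} → Walk Adj□ x y → Walk AdjH (proj₂ x) (proj₂ y)
  projH []            = []
  projH (stepG e ∷ w) = projH w
  projH (stepH e ∷ w) = e ∷ projH w

  ∈-projG : ∀ {v x y} (w : Walk Adj□ x y) → v ∈W w → proj₁ v ∈W projG w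
  ∈-projG w             here      = here
  ∈-projG (stepG e ∷ w) (there m) = there (∈-projG w m)
  ∈-projG (stepH e ∷ w) (there m) = ∈-projG w m

  ∈-projH : ∀ {v x y} (w : Walk Adj□ x y) → v ∈W w → proj₂ v ∈W projH w
  ∈-projH w             here      = here
  ∈-projH (stepG e ∷ w) (there m) = ∈-projH w m
  ∈-projH (stepH e ∷ w) (there m) = there (∈-projH w m)

  length-projG+projH : ∀ {x y} (w : Walk Adj□ x y) →
                       length w ≡ length (projG w) + length (projH w)
  length-projG+projH []            = refl
  length-projG+projH (stepG e ∷ w) = cong suc (length-projG+projH w)
  length-projG+projH (stepH e ∷ w) =
    trans (cong suc (length-projG+projH w)) (sym (+-suc (length (projG w)) _))

  liftG : ∀ h {g₁ g₂} → Walk AdjG g₁ g₂ → Walk Adj□ (g₁ , h) (g₂ , h)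
  liftG h = mapᵂ (_, h) stepG

  liftH : ∀ g {h₁ h₂} → Walk AdjH h₁ h₂ → Walk Adj□ (g , h₁) (g , h₂)
  liftH g = mapᵂ (g ,_) stepH

  length-liftG : ∀ h {g₁ g₂} (p : Walk AdjG g₁ g₂) → length (liftG h p) ≡ length p
  length-liftG h = length-mapᵂ (_, h) stepG

  length-liftH : ∀ g {h₁ h₂} (p : Walk AdjH h₁ h₂) → length (liftH g p) ≡ length p
  length-liftH g = length-mapᵂ (g ,_) stepH

  projG-shortest : ∀ {x y} (w : Walk Adj□ x y) → IsShortest w → IsShortest (projG w)
  projG-shortest {x} {y} w w-shortest p = +-cancelʳ-≤ (length (projH w)) _ _ (begin
    length (projG w) + length (projH w)     ≡⟨ sym (length-projG+projH w) ⟩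
    length w                                ≤⟨ w-shortest detour ⟩
    length detour                           ≡⟨ length-++ᵂ (liftG (proj₂ x) p) _ ⟩
    length (liftG (proj₂ x) p) + length (liftH (proj₁ y) (projH w))
      ≡⟨ cong₂ _+_ (length-liftG _ p) (length-liftH _ (projH w)) ⟩
    length p + length (projH w)             ∎)
    where
    detour : Walk Adj□ x y
    detour = liftG (proj₂ x) p ++ᵂ liftH (proj₁ y) (projH w)

  projH-shortest : ∀ {x y} (w : Walk Adj□ x y) → IsShortest w → IsShortest (projH w)
  projH-shortest {x} {y} w w-shortest p = +-cancelʳ-≤ (length (projG w)) _ _ (begin
    length (projH w) + length (projG w)     ≡⟨ +-comm (length (projH w)) _ ⟩
    length (projG w) + length (projH w)     ≡⟨ sym (length-projG+projH w) ⟩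
    length w                                ≤⟨ w-shortest detour ⟩
    length detour                           ≡⟨ length-++ᵂ (liftH (proj₁ x) p) _ ⟩
    length (liftH (proj₁ x) p) + length (liftG (proj₂ y) (projG w))
      ≡⟨ cong₂ _+_ (length-liftH _ p) (length-liftG _ (projG w)) ⟩
    length p + length (projG w)             ∎)
    where
    detour : Walk Adj□ x y
    detour = liftH (proj₁ x) p ++ᵂ liftG (proj₂ y) (projG w)

Distinct₃ : {A : Set} → A → A → A → Set
Distinct₃ a b c = ¬ a ≡ b × ¬ b ≡ c × ¬ a ≡ c

Coincide₃ : {A : Set} → A → A → A → Set
Coincide₃ a b c = a ≡ b ⊎ b ≡ c ⊎ a ≡ c

coincide₃-or-distinct₃ : {A : Set} → DecidableEquality A → (a b c : A) →
                         Coincide₃ a b c ⊎ Distinct₃ a b c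
coincide₃-or-distinct₃ _≟ᴬ_ a b c with a ≟ᴬ b | b ≟ᴬ c | a ≟ᴬ c
... | yes a≡b | _       | _       = inj₁ (inj₁ a≡b)
... | no _    | yes b≡c | _       = inj₁ (inj₂ (inj₁ b≡c))
... | no _    | no _    | yes a≡c = inj₁ (inj₂ (inj₂ a≡c))
... | no a≢b  | no b≢c  | no a≢c  = inj₂ (a≢b , b≢c , a≢c)

module _ {A B : Set} (R : A × B → Set) where

  LineExclusive : Set
  LineExclusive = ∀ a b → R (a , b) →
    (∀ b′ → R (a , b′) → b′ ≡ b) ⊎ (∀ a′ → R (a′ , b) → a′ ≡ a)

  no-corner : LineExclusive → ∀ {p q r} → R p → R q → R r →
              proj₁ p ≡ proj₁ q → proj₂ p ≡ proj₂ r → ¬ p ≡ q → ¬ p ≡ r → ⊥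
  no-corner exclusive {a , b} {_ , b′} {a′ , _} Rp Rq Rr refl refl p≢q p≢r
    with exclusive a b Rp
  ... | inj₁ alone-on-B-line = p≢q (×-≡,≡→≡ (refl , sym (alone-on-B-line b′ Rq)))
  ... | inj₂ alone-on-A-line = p≢r (×-≡,≡→≡ (sym (alone-on-A-line a′ Rr) , refl))

  distinct₃-coordinates : DecidableEquality A → DecidableEquality B → LineExclusive →
    ∀ {p q r} → R p → R q → R r → Distinct₃ p q r →
    Distinct₃ (proj₁ p) (proj₁ q) (proj₁ r) ⊎ Distinct₃ (proj₂ p) (proj₂ q) (proj₂ r)
  distinct₃-coordinates _≟ᴬ_ _≟ᴮ_ exclusive {p} {q} {r} Rp Rq Rr (p≢q , q≢r , p≢r)
    with coincide₃-or-distinct₃ _≟ᴬ_ (proj₁ p) (proj₁ q) (proj₁ r)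
       | coincide₃-or-distinct₃ _≟ᴮ_ (proj₂ p) (proj₂ q) (proj₂ r)
  ... | inj₂ distinctᴬ | _ = inj₁ distinctᴬ
  ... | inj₁ _ | inj₂ distinctᴮ = inj₂ distinctᴮ
  ... | inj₁ (inj₁ pq) | inj₁ (inj₁ pq′) = ⊥-elim (p≢q (×-≡,≡→≡ (pq , pq′)))
  ... | inj₁ (inj₂ (inj₁ qr)) | inj₁ (inj₂ (inj₁ qr′)) = ⊥-elim (q≢r (×-≡,≡→≡ (qr , qr′)))
  ... | inj₁ (inj₂ (inj₂ pr)) | inj₁ (inj₂ (inj₂ pr′)) = ⊥-elim (p≢r (×-≡,≡→≡ (pr , pr′)))
  ... | inj₁ (inj₁ pq) | inj₁ (inj₂ (inj₁ qr)) =
    ⊥-elim (no-corner exclusive Rq Rp Rr (sym pq) qr (p≢q ∘ sym) q≢r)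
  ... | inj₁ (inj₁ pq) | inj₁ (inj₂ (inj₂ pr)) =
    ⊥-elim (no-corner exclusive Rp Rq Rr pq pr p≢q p≢r)
  ... | inj₁ (inj₂ (inj₁ qr)) | inj₁ (inj₁ pq) =
    ⊥-elim (no-corner exclusive Rq Rr Rp qr (sym pq) q≢r (p≢q ∘ sym))
  ... | inj₁ (inj₂ (inj₁ qr)) | inj₁ (inj₂ (inj₂ pr)) =
    ⊥-elim (no-corner exclusive Rr Rq Rp (sym qr) (sym pr) (q≢r ∘ sym) (p≢r ∘ sym))
  ... | inj₁ (inj₂ (inj₂ pr)) | inj₁ (inj₁ pq) =
    ⊥-elim (no-corner exclusive Rp Rr Rq pr pq p≢r p≢q)
  ... | inj₁ (inj₂ (inj₂ pr)) | inj₁ (inj₂ (inj₁ qr)) =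
    ⊥-elim (no-corner exclusive Rr Rp Rq (sym pr) (sym qr) (p≢r ∘ sym) (q≢r ∘ sym))

lemma3p2 : (G H : Graph) → Connected (Graph.Adj G) → Connected (Graph.Adj H) →
    (R : V G × V H → Set) →
    (∀ g h → R (g , h) →
       (∀ h′ → R (g , h′) → h′ ≡ h) ⊎ (∀ g′ → R (g′ , h) → g′ ≡ g)) →
    GeneralPosition (Graph.Adj G) (πG G H R) →
    GeneralPosition (Graph.Adj H) (πH G H R) →
    GeneralPosition (□Adj G H) R
lemma3p2 G H _ _ R exclusive gpG gpH a b c Ra Rb Rc a≢b b≢c a≢c w w-shortest (a∈w , b∈w , c∈w)
  with distinct₃-coordinates R _≟_ _≟_ exclusive Ra Rb Rc (a≢b , b≢c , a≢c)
... | inj₁ (a₁≢b₁ , b₁≢c₁ , a₁≢c₁) =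
  gpG _ _ _ (_ , Ra) (_ , Rb) (_ , Rc) a₁≢b₁ b₁≢c₁ a₁≢c₁
      (projG G H w) (projG-shortest G H w w-shortest)
      (∈-projG G H w a∈w , ∈-projG G H w b∈w , ∈-projG G H w c∈w)
... | inj₂ (a₂≢b₂ , b₂≢c₂ , a₂≢c₂) =
  gpH _ _ _ (_ , Ra) (_ , Rb) (_ , Rc) a₂≢b₂ b₂≢c₂ a₂≢c₂
      (projH G H w) (projH-shortest G H w w-shortest)
      (∈-projH G H w a∈w , ∈-projH G H w b∈w , ∈-projH G H w c∈w)
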